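{- Let $k$ be a non-negative integer, let $G\in\Delta_k$ and let $v\in V(G)$. Then the rooted graph $(G,v)$ has at least $2^{k+1}$ orbits.
   Context: Graphs are finite and simple. $\Delta_0=\{K_2\}$. For $i\ge1$, $\Delta_i$ is the set of all graphs obtained from the disjoint union of three (not necessarily distinct) graphs in $\Delta_{i-1}$ by choosing one vertex in each and adding a triangle on the three chosen vertices, up to isomorphism. An automorphism of the rooted graph $(G,v)$ is an automorphism of $G$ fixing $v$. The orbit of $x\in V(G)$ in $(G,v)$ is $\{f(x): f\text{ an automorphism of }(G,v)\}$, and the number of orbits is the number of distinct such sets. -}

module Defs where

open import Data.Nat using (ℕ; suc; _+_)
open import Data.Bool using (Bool; true; false; not; _∧_)
open import Data.Fin using (Fin; splitAt; _≟_)
open import Data.Sum using (_⊎_; inj₁; inj₂; map₂)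
open import Data.Product using (Σ; _×_; ∃)
open import Relation.Nullary.Decidable using (⌊_⌋)
open import Relation.Binary.PropositionalEquality using (_≡_)
open import Function.Bundles using (_↔_; Inverse)

-- A finite graph on vertex set Fin n, given by a Bool-valued adjacency
-- function.  (Every graph in Δ_k is automatically simple: symmetric and
-- loopless, since K₂ is and the gluing preserves it, and membership is
-- closed under isomorphism.)
record Graph : Set where
  field
    n   : ℕ
    adj : Fin n → Fin n → Bool
open Graph public

Iso : Graph → Graph → Set
Iso G H = Σ (Fin (n G) ↔ Fin (n H)) λ f →
  ∀ x y → adj H (Inverse.to f x) (Inverse.to f y) ≡ adj G x y

K₂ : Graph
K₂ = record { n = 2 ; adj = λ x y → not ⌊ x ≟ y ⌋ }

-- Disjoint union of G₁, G₂, G₃ plus a triangle on v₁, v₂, v₃.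
module _ (G₁ G₂ G₃ : Graph) (v₁ : Fin (n G₁)) (v₂ : Fin (n G₂)) (v₃ : Fin (n G₃)) where
  private
    V : Set
    V = Fin (n G₁) ⊎ (Fin (n G₂) ⊎ Fin (n G₃))

    isRoot : V → Bool
    isRoot (inj₁ a)        = ⌊ a ≟ v₁ ⌋
    isRoot (inj₂ (inj₁ a)) = ⌊ a ≟ v₂ ⌋
    isRoot (inj₂ (inj₂ a)) = ⌊ a ≟ v₃ ⌋

    triAdj : V → V → Bool
    triAdj (inj₁ a)        (inj₁ b)        = adj G₁ a b
    triAdj (inj₂ (inj₁ a)) (inj₂ (inj₁ b)) = adj G₂ a b
    triAdj (inj₂ (inj₂ a)) (inj₂ (inj₂ b)) = adj G₃ a b
    triAdj x               y               = isRoot x ∧ isRoot y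

    split : Fin (n G₁ + (n G₂ + n G₃)) → V
    split x = map₂ (splitAt (n G₂)) (splitAt (n G₁) x)

  glue : Graph
  glue = record { n = n G₁ + (n G₂ + n G₃) ; adj = λ x y → triAdj (split x) (split y) }

data Δ : ℕ → Graph → Set where
  base : ∀ {H} → Iso K₂ H → Δ 0 H
  step : ∀ {k H} (G₁ G₂ G₃ : Graph) →
         Δ k G₁ → Δ k G₂ → Δ k G₃ →
         (v₁ : Fin (n G₁)) (v₂ : Fin (n G₂)) (v₃ : Fin (n G₃)) →
         Iso (glue G₁ G₂ G₃ v₁ v₂ v₃) H → Δ (suc k) H

RootedAut : (G : Graph) → Fin (n G) → Set
RootedAut G v = Σ (Fin (n G) ↔ Fin (n G)) λ f →
  (∀ x y → adj G (Inverse.to f x) (Inverse.to f y) ≡ adj G x y) × (Inverse.to f v ≡ v)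

InOrbit : (G : Graph) → Fin (n G) → Fin (n G) → Fin (n G) → Set
InOrbit G v x y = Σ (RootedAut G v) λ f → Inverse.to (Data.Product.proj₁ f) x ≡ y

-- (G , v) has at least N orbits: there are N vertices with pairwise
-- distinct orbits (orbits partition V(G)).
AtLeastOrbits : (G : Graph) → Fin (n G) → ℕ → Set
AtLeastOrbits G v N = Σ (Fin N → Fin (n G)) λ r →
  ∀ i j → InOrbit G v (r i) (r j) → i ≡ j

-- Write G ∈ Δ_{k+1} as the union of connected G₁, G₂, G₃ ∈ Δ_k, all of the same order m, glued
-- along the triangle r₁r₂r₃, and let v lie in part i₀ with root R = r_{i₀}.  Call x a large
-- separator if it cuts off more than m vertices from v.  R is one (it cuts off itself and a whole
-- other part), and every large separator cuts R off from v, since a vertex that leaves R reachable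
-- cuts off vertices of a single part only.  Separation being antisymmetric, this last large
-- separator is unique, so every automorphism of (G, v) fixes R.  It then maps the other roots, the
-- neighbours of R with more than m vertices beyond R, to roots, hence maps parts to parts, keeping
-- part i₀.  An automorphism moving a vertex of another part j₀ inside part j₀ must therefore fix
-- r_{j₀}.  Restricting to parts, the orbits of (G_{i₀}, v) and of (G_{j₀}, r_{j₀}) stay distinct in
-- (G, v), which gives 2^{k+1} + 2^{k+1} orbits.
module Submission where

open import Defs
open import Data.Bool using (Bool; true; _∧_)
open import Data.Empty using (⊥-elim)
open import Data.Fin using (Fin; zero; suc; splitAt; join; _≟_)
open import Data.Fin.Permutation using (↔⇒≡)
open import Data.Fin.Properties using (injective⇒≤; splitAt-join; join-splitAt; +↔⊎)
open import Data.Nat using (ℕ; suc; _+_; _^_)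
open import Data.Nat.Properties using (+-identityʳ; n≮n)
open import Data.Product using (Σ; _×_; _,_; proj₁; proj₂)
open import Data.Product.Properties using (≡-dec)
open import Data.Sum using (_⊎_; inj₁; inj₂; [_,_]; map₂)
open import Data.Unit using (⊤; tt)
open import Function using (_∘_; Injective; case_of_)
open import Function.Bundles using (_↔_; Inverse; Injection; mk↔ₛ′)
open import Function.Properties.Inverse using (↔-sym; ↔-trans; Inverse⇒Injection)
open import Relation.Binary.Definitions using (DecidableEquality)
open import Relation.Binary.PropositionalEquality
  using (_≡_; _≢_; refl; sym; trans; cong; cong₂; subst; subst₂; module ≡-Reasoning)
open import Relation.Nullary using (¬_; yes; no)
open import Relation.Nullary.Decidable using (⌊_⌋)

-- Defs.Graph with an arbitrary vertex type; the notions below are chosen so that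
-- OrbitsAtLeast (toSetGraph G) is definitionally Defs.AtLeastOrbits G.
record SetGraph : Set₁ where
  constructor setGraph
  field
    Vertex : Set
    edge   : Vertex → Vertex → Bool
open SetGraph public

toSetGraph : Graph → SetGraph
toSetGraph G = setGraph (Fin (n G)) (adj G)

PreservesEdges : (T T′ : SetGraph) → (Vertex T → Vertex T′) → Set
PreservesEdges T T′ f = ∀ x y → edge T′ (f x) (f y) ≡ edge T x y

_≅_ : SetGraph → SetGraph → Set
T ≅ T′ = Σ (Vertex T ↔ Vertex T′) λ φ → PreservesEdges T T′ (Inverse.to φ)

RootedAutomorphism : (T : SetGraph) → Vertex T → Set
RootedAutomorphism T v =
  Σ (Vertex T ↔ Vertex T) λ f → PreservesEdges T T (Inverse.to f) × (Inverse.to f v ≡ v)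

SameOrbit : (T : SetGraph) → Vertex T → Vertex T → Vertex T → Set
SameOrbit T v x y = Σ (RootedAutomorphism T v) λ g → Inverse.to (proj₁ g) x ≡ y

DistinctOrbits : (T : SetGraph) → Vertex T → {I : Set} → (I → Vertex T) → Set
DistinctOrbits T v r = ∀ i j → SameOrbit T v (r i) (r j) → i ≡ j

OrbitsAtLeast : (T : SetGraph) → Vertex T → ℕ → Set
OrbitsAtLeast T v N = Σ (Fin N → Vertex T) (DistinctOrbits T v)

↔-injective : ∀ {A B : Set} (f : A ↔ B) → Injective _≡_ _≡_ (Inverse.to f)
↔-injective f = Injection.injective (Inverse⇒Injection f)

preservesEdges-inverse : ∀ {T T′} (φ : Vertex T ↔ Vertex T′) →
  PreservesEdges T T′ (Inverse.to φ) → PreservesEdges T′ T (Inverse.from φ)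
preservesEdges-inverse {T} {T′} φ hom x y = begin
  edge T (from x) (from y)             ≡⟨ hom (from x) (from y) ⟨
  edge T′ (to (from x)) (to (from y))  ≡⟨ cong₂ (edge T′) (strictlyInverseˡ x) (strictlyInverseˡ y) ⟩
  edge T′ x y                          ∎
  where open Inverse φ
        open ≡-Reasoning

≅-sym : ∀ {T T′} → T ≅ T′ → T′ ≅ T
≅-sym {T} {T′} (φ , hom) = ↔-sym φ , preservesEdges-inverse {T} {T′} φ hom

module _ {T : SetGraph} {v : Vertex T} where

  ⟦_⟧ : RootedAutomorphism T v → Vertex T → Vertex T
  ⟦ g ⟧ = Inverse.to (proj₁ g)

  _⁻¹ : RootedAutomorphism T v → RootedAutomorphism T v
  (f , hom , fixes) ⁻¹ =
    ↔-sym f , preservesEdges-inverse f hom ,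
    trans (cong (Inverse.from f) (sym fixes)) (Inverse.strictlyInverseʳ f v)

  module _ (g : RootedAutomorphism T v) where
    ⟦⟧-edge : PreservesEdges T T ⟦ g ⟧
    ⟦⟧-edge = proj₁ (proj₂ g)

    ⟦⟧-root : ⟦ g ⟧ v ≡ v
    ⟦⟧-root = proj₂ (proj₂ g)

    ⟦⟧-injective : Injective _≡_ _≡_ ⟦ g ⟧
    ⟦⟧-injective = ↔-injective (proj₁ g)

    ⟦⟧-inverseˡ : ∀ x → ⟦ g ⟧ (⟦ g ⁻¹ ⟧ x) ≡ x
    ⟦⟧-inverseˡ = Inverse.strictlyInverseˡ (proj₁ g)

    ⟦⟧-inverseʳ : ∀ x → ⟦ g ⁻¹ ⟧ (⟦ g ⟧ x) ≡ x
    ⟦⟧-inverseʳ = Inverse.strictlyInverseʳ (proj₁ g)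

module _ {T : SetGraph} {v : Vertex T} where

  sameOrbit-sym : ∀ {x y} → SameOrbit T v x y → SameOrbit T v y x
  sameOrbit-sym {x} (g , gx≡y) = g ⁻¹ , trans (cong ⟦ g ⁻¹ ⟧ (sym gx≡y)) (⟦⟧-inverseʳ g x)

  distinctOrbits-⊎ : ∀ {A B} {r : A → Vertex T} {s : B → Vertex T} →
    DistinctOrbits T v r → DistinctOrbits T v s → (∀ a b → ¬ SameOrbit T v (r a) (s b)) →
    DistinctOrbits T v [ r , s ]
  distinctOrbits-⊎ r-distinct _ _     (inj₁ a) (inj₁ a′) o = cong inj₁ (r-distinct a a′ o)
  distinctOrbits-⊎ _ _ apart          (inj₁ a) (inj₂ b)  o = ⊥-elim (apart a b o)
  distinctOrbits-⊎ _ _ apart          (inj₂ b) (inj₁ a)  o = ⊥-elim (apart a b (sameOrbit-sym o))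
  distinctOrbits-⊎ _ s-distinct _     (inj₂ b) (inj₂ b′) o = cong inj₂ (s-distinct b b′ o)

  distinctOrbits-∘ : ∀ {A B} {r : B → Vertex T} {f : A → B} →
    Injective _≡_ _≡_ f → DistinctOrbits T v r → DistinctOrbits T v (r ∘ f)
  distinctOrbits-∘ f-injective r-distinct i j o = f-injective (r-distinct _ _ o)

  orbitsAtLeast-+ : ∀ {A B} (r : Fin A → Vertex T) (s : Fin B → Vertex T) →
    DistinctOrbits T v r → DistinctOrbits T v s → (∀ a b → ¬ SameOrbit T v (r a) (s b)) →
    OrbitsAtLeast T v (A + B)
  orbitsAtLeast-+ {A} {B} r s r-distinct s-distinct apart =
    [ r , s ] ∘ splitAt A ,
    distinctOrbits-∘ (↔-injective (+↔⊎ {A} {B})) (distinctOrbits-⊎ r-distinct s-distinct apart)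

conjugate : ∀ {T T′} (Φ : T ≅ T′) {v′} → RootedAutomorphism T′ v′ →
  RootedAutomorphism T (Inverse.from (proj₁ Φ) v′)
conjugate {T} {T′} (φ , hom) {v′} (f , f-hom , f-root) =
  ↔-trans φ (↔-trans f (↔-sym φ)) ,
  (λ x y → trans (preservesEdges-inverse {T} {T′} φ hom _ _) (trans (f-hom _ _) (hom x y))) ,
  cong (Inverse.from φ) (trans (cong (Inverse.to f) (Inverse.strictlyInverseˡ φ v′)) f-root)

orbitsAtLeast-≅ : ∀ {T T′ N} → T ≅ T′ → (∀ v → OrbitsAtLeast T v N) →
  ∀ v′ → OrbitsAtLeast T′ v′ N
orbitsAtLeast-≅ Φ@(φ , _) orbits v′ =
  Inverse.to φ ∘ r , λ i j (g , g-maps) →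
    r-distinct i j (conjugate Φ g ,
                    trans (cong (Inverse.from φ) g-maps) (Inverse.strictlyInverseʳ φ (r j)))
  where
  r = proj₁ (orbits (Inverse.from φ v′))
  r-distinct = proj₂ (orbits (Inverse.from φ v′))

data Walk (T : SetGraph) (P : Vertex T → Set) : Vertex T → Vertex T → Set where
  stay : ∀ {a} → P a → Walk T P a a
  step : ∀ {a b c} → P a → edge T a b ≡ true → Walk T P b c → Walk T P a c

module _ {T : SetGraph} {P : Vertex T → Set} where

  walk-start : ∀ {a b} → Walk T P a b → P a
  walk-start (stay p)     = p
  walk-start (step p _ _) = p

  walk-end : ∀ {a b} → Walk T P a b → P b
  walk-end (stay p)     = p
  walk-end (step _ _ w) = walk-end w

  _++ʷ_ : ∀ {a b c} → Walk T P a b → Walk T P b c → Walk T P a c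
  stay _     ++ʷ w′ = w′
  step p e w ++ʷ w′ = step p e (w ++ʷ w′)

  walk-weaken : ∀ {Q : Vertex T → Set} → (∀ {w} → P w → Q w) →
    ∀ {a b} → Walk T P a b → Walk T Q a b
  walk-weaken P⇒Q (stay p)     = stay (P⇒Q p)
  walk-weaken P⇒Q (step p e w) = step (P⇒Q p) e (walk-weaken P⇒Q w)

walk-map : ∀ {T T′} (f : Vertex T → Vertex T′) → PreservesEdges T T′ f →
  ∀ {P Q} → (∀ {w} → P w → Q (f w)) → ∀ {a b} → Walk T P a b → Walk T′ Q (f a) (f b)
walk-map f hom P⇒Q (stay p)             = stay (P⇒Q p)
walk-map f hom P⇒Q (step {a} {b} p e w) =
  step (P⇒Q p) (trans (hom a b) e) (walk-map f hom P⇒Q w)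

Connected : SetGraph → Set
Connected T = ∀ a b → Walk T (λ _ → ⊤) a b

connected-≅ : ∀ {T T′} → T ≅ T′ → Connected T → Connected T′
connected-≅ {T} {T′} (φ , hom) connected a b =
  subst₂ (Walk T′ _) (strictlyInverseˡ a) (strictlyInverseˡ b)
    (walk-map to hom (λ _ → tt) (connected (from a) (from b)))
  where open Inverse φ

MoreThan : ℕ → {A : Set} → (A → Set) → Set
MoreThan m {A} X = Σ (Fin (suc m) → A) λ e → Injective _≡_ _≡_ e × (∀ p → X (e p))

module _ {A : Set} {X : A → Set} {m : ℕ} where

  moreThan-map : ∀ {B : Set} {Y : B → Set} (f : A → B) → Injective _≡_ _≡_ f →
    (∀ {x} → X x → Y (f x)) → MoreThan m X → MoreThan m Y
  moreThan-map f f-injective X⇒Y (e , e-injective , e-in) =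
    f ∘ e , e-injective ∘ f-injective , X⇒Y ∘ e-in

  ¬moreThan : (f : ∀ {x} → X x → Fin m) →
    (∀ {x y} (px : X x) (py : X y) → f px ≡ f py → x ≡ y) → ¬ MoreThan m X
  ¬moreThan f f-injective (e , e-injective , e-in) =
    n≮n m (injective⇒≤ (λ {p} {q} eq → e-injective (f-injective (e-in p) (e-in q) eq)))

Separates : (T : SetGraph) → Vertex T → Vertex T → Vertex T → Set
Separates T v x y = ¬ Walk T (_≢ x) v y

module _ {T : SetGraph} (_≟ᵥ_ : DecidableEquality (Vertex T)) where

  walk-meets-first : ∀ {x y a} → x ≢ y → Walk T (λ _ → ⊤) a y →
    Walk T (_≢ y) a x ⊎ Walk T (_≢ x) a y
  walk-meets-first x≢y (stay _) = inj₂ (stay (x≢y ∘ sym))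
  walk-meets-first {x} {y} {a} x≢y (step _ e w) with a ≟ᵥ x | a ≟ᵥ y
  ... | yes refl | _        = inj₁ (stay x≢y)
  ... | no a≢x   | yes refl = inj₂ (stay a≢x)
  ... | no a≢x   | no a≢y   with walk-meets-first x≢y w
  ...   | inj₁ w′ = inj₁ (step a≢y e w′)
  ...   | inj₂ w′ = inj₂ (step a≢x e w′)

  separates-antisym : Connected T → ∀ {v x y} → Separates T v x y → Separates T v y x → x ≡ y
  separates-antisym connected {v} {x} {y} x-sep-y y-sep-x with x ≟ᵥ y
  ... | yes x≡y = x≡y
  ... | no x≢y with walk-meets-first x≢y (connected v y)
  ...   | inj₁ w = ⊥-elim (y-sep-x w)
  ...   | inj₂ w = ⊥-elim (x-sep-y w)

module _ {T : SetGraph} {v : Vertex T} where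

  separates-map : (g : RootedAutomorphism T v) → ∀ {x y} →
    Separates T v x y → Separates T v (⟦ g ⟧ x) (⟦ g ⟧ y)
  separates-map g {x} {y} x-sep-y w =
    x-sep-y (subst₂ (Walk T _) (⟦⟧-root (g ⁻¹)) (⟦⟧-inverseʳ g y)
      (walk-map ⟦ g ⁻¹ ⟧ (⟦⟧-edge (g ⁻¹))
        (λ {w} w≢gx g⁻¹w≡x → w≢gx (trans (sym (⟦⟧-inverseˡ g w)) (cong ⟦ g ⟧ g⁻¹w≡x))) w))

  LargeSeparator : ℕ → Vertex T → Set
  LargeSeparator m x = MoreThan m (Separates T v x)

  IsLastLargeSeparator : ℕ → Vertex T → Set
  IsLastLargeSeparator m x = LargeSeparator m x × ∀ y → LargeSeparator m y → Separates T v y x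

  largeSeparator-map : ∀ {m} (g : RootedAutomorphism T v) → ∀ {x} →
    LargeSeparator m x → LargeSeparator m (⟦ g ⟧ x)
  largeSeparator-map g {x} =
    moreThan-map {Y = Separates T v (⟦ g ⟧ x)} ⟦ g ⟧ (⟦⟧-injective g) (separates-map g)

  isLastLargeSeparator-map : ∀ {m} (g : RootedAutomorphism T v) → ∀ {x} →
    IsLastLargeSeparator m x → IsLastLargeSeparator m (⟦ g ⟧ x)
  isLastLargeSeparator-map g (x-large , x-last) =
    largeSeparator-map g x-large ,
    λ y y-large → subst (λ z → Separates T v z _) (⟦⟧-inverseˡ g y)
      (separates-map g (x-last _ (largeSeparator-map (g ⁻¹) y-large)))

  lastLargeSeparator-fixed : DecidableEquality (Vertex T) → Connected T →
    ∀ {m x} → IsLastLargeSeparator m x → (g : RootedAutomorphism T v) → ⟦ g ⟧ x ≡ x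
  lastLargeSeparator-fixed _≟ᵥ_ connected x-last g =
    separates-antisym _≟ᵥ_ connected (proj₂ x-last _ (proj₁ gx-last)) (proj₂ gx-last _ (proj₁ x-last))
    where gx-last = isLastLargeSeparator-map g x-last

avoid : (i j : Fin 3) → Σ (Fin 3) λ l → l ≢ i × l ≢ j
avoid zero             zero             = suc zero       , (λ ()) , (λ ())
avoid zero             (suc zero)       = suc (suc zero) , (λ ()) , (λ ())
avoid zero             (suc (suc zero)) = suc zero       , (λ ()) , (λ ())
avoid (suc zero)       zero             = suc (suc zero) , (λ ()) , (λ ())
avoid (suc zero)       (suc zero)       = zero           , (λ ()) , (λ ())
avoid (suc zero)       (suc (suc zero)) = zero           , (λ ()) , (λ ())
avoid (suc (suc zero)) zero             = suc zero       , (λ ()) , (λ ())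
avoid (suc (suc zero)) (suc zero)       = zero           , (λ ()) , (λ ())
avoid (suc (suc zero)) (suc (suc zero)) = zero           , (λ ()) , (λ ())

module Glued (G : Fin 3 → Graph) (r : (i : Fin 3) → Fin (n (G i))) where

  open ≡-Reasoning

  V : Set
  V = Σ (Fin 3) λ i → Fin (n (G i))

  part : V → Fin 3
  part = proj₁

  root : Fin 3 → V
  root i = i , r i

  -- The adjacency of Defs.glue, read on Σ (Fin 3) instead of nested sums of Fins.
  _~_ : V → V → Bool
  (i , a) ~ (j , b) with i ≟ j
  ... | yes refl = adj (G i) a b
  ... | no _     = ⌊ a ≟ r i ⌋ ∧ ⌊ b ≟ r j ⌋

  glued : SetGraph
  glued = setGraph V _~_

  IsRoot : V → Set
  IsRoot w = w ≡ root (part w)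

  _≟ᵥ_ : DecidableEquality V
  _≟ᵥ_ = ≡-dec _≟_ _≟_

  coordinate-injective : ∀ {i} {a b : Fin (n (G i))} → _≡_ {A = V} (i , a) (i , b) → a ≡ b
  coordinate-injective refl = refl

  inPart : ∀ {i w} → part w ≡ i → Σ (Fin (n (G i))) λ a → w ≡ (i , a)
  inPart {w = _ , a} refl = a , refl

  ~-within : ∀ i a b → (i , a) ~ (i , b) ≡ adj (G i) a b
  ~-within i a b with i ≟ i
  ... | yes refl = refl
  ... | no i≢i   = ⊥-elim (i≢i refl)

  ~-roots : ∀ {i j} → i ≢ j → root i ~ root j ≡ true
  ~-roots {i} {j} i≢j with i ≟ j
  ... | yes i≡j = ⊥-elim (i≢j i≡j)
  ... | no _ with r i ≟ r i | r j ≟ r j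
  ...   | yes _    | yes _    = refl
  ...   | no ri≢ri | _        = ⊥-elim (ri≢ri refl)
  ...   | yes _    | no rj≢rj = ⊥-elim (rj≢rj refl)

  ~-across : ∀ {i j a b} → i ≢ j → (i , a) ~ (j , b) ≡ true → a ≡ r i × b ≡ r j
  ~-across {i} {j} {a} {b} i≢j a~b with i ≟ j
  ... | yes i≡j = ⊥-elim (i≢j i≡j)
  ... | no _ with a ≟ r i | b ≟ r j
  ...   | yes a≡r | yes b≡r = a≡r , b≡r
  ...   | no _    | _       = case a~b of λ ()
  ...   | yes _   | no _    = case a~b of λ ()

  walk-across : ∀ {P i j z} → i ≢ j → P (root i) →
    Walk glued P (root j) z → Walk glued P (root i) z
  walk-across i≢j p w = step p (~-roots i≢j) w

  walk-exits-via-root : ∀ {P i a y} → Walk glued P (i , a) y → part y ≢ i → P (root i)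
  walk-exits-via-root (stay _) y∉i = ⊥-elim (y∉i refl)
  walk-exits-via-root {P} {i} (step {b = j , b} p a~b w) y∉i with j ≟ i
  ... | yes refl = walk-exits-via-root w y∉i
  ... | no j≢i   = subst (λ c → P (i , c)) (proj₁ (~-across (j≢i ∘ sym) a~b)) p

  walk-stays-in-part : ∀ {P i a y} → ¬ P (root i) → Walk glued P (i , a) y → part y ≡ i
  walk-stays-in-part {i = i} {y = y} ¬P-root w with part y ≟ i
  ... | yes y∈i = y∈i
  ... | no y∉i  = ⊥-elim (¬P-root (walk-exits-via-root w y∉i))

  walk-enters-via-root : ∀ {P x i a} → Walk glued P x (i , a) → part x ≢ i → P (root i)
  walk-enters-via-root (stay _) x∉i = ⊥-elim (x∉i refl)
  walk-enters-via-root {P} {i = i} (step {b = j , b} p x~b w) x∉i with j ≟ i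
  ... | no j≢i   = walk-enters-via-root w j≢i
  ... | yes refl = subst (λ c → P (i , c)) (proj₂ (~-across x∉i x~b)) (walk-start w)

  module _ (connected : ∀ i → Connected (toSetGraph (G i))) where

    walk-within : ∀ {P} i → (∀ c → P (i , c)) → ∀ a b → Walk glued P (i , a) (i , b)
    walk-within i P-on-i a b =
      walk-map (i ,_) (λ x y → ~-within i x y) (λ {c} _ → P-on-i c) (connected i a b)

    walk-between : ∀ {P} i j → (∀ c → P (i , c)) → (∀ c → P (j , c)) →
      ∀ a b → Walk glued P (i , a) (j , b)
    walk-between i j P-on-i P-on-j a b with i ≟ j
    ... | yes refl = walk-within i P-on-i a b
    ... | no i≢j   = walk-within i P-on-i a (r i) ++ʷ
                     walk-across i≢j (P-on-i (r i)) (walk-within j P-on-j (r j) b)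

    glued-connected : Connected glued
    glued-connected (i , a) (j , b) = walk-between i j (λ _ → tt) (λ _ → tt) a b

  restrict : ∀ {v} p ρ (g : RootedAutomorphism glued v) → ⟦ g ⟧ (p , ρ) ≡ (p , ρ) →
    (∀ a → part (⟦ g ⟧ (p , a)) ≡ p) → (∀ a → part (⟦ g ⁻¹ ⟧ (p , a)) ≡ p) →
    Σ (RootedAutomorphism (toSetGraph (G p)) ρ) λ h → ∀ a → ⟦ g ⟧ (p , a) ≡ (p , ⟦ h ⟧ a)
  restrict p ρ g fixes-ρ g-keeps-p g⁻¹-keeps-p =
    (mk↔ₛ′ to from to-from from-to , to-edge , to-ρ) , to-spec
    where
    to from : Fin (n (G p)) → Fin (n (G p))
    to   a = proj₁ (inPart (g-keeps-p a))
    from a = proj₁ (inPart (g⁻¹-keeps-p a))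
    to-spec : ∀ a → ⟦ g ⟧ (p , a) ≡ (p , to a)
    to-spec a = proj₂ (inPart (g-keeps-p a))
    from-spec : ∀ a → ⟦ g ⁻¹ ⟧ (p , a) ≡ (p , from a)
    from-spec a = proj₂ (inPart (g⁻¹-keeps-p a))
    to-from : ∀ a → to (from a) ≡ a
    to-from a = coordinate-injective (begin
      (p , to (from a))       ≡⟨ to-spec (from a) ⟨
      ⟦ g ⟧ (p , from a)      ≡⟨ cong ⟦ g ⟧ (from-spec a) ⟨
      ⟦ g ⟧ (⟦ g ⁻¹ ⟧ (p , a)) ≡⟨ ⟦⟧-inverseˡ g (p , a) ⟩
      (p , a)                 ∎)
    from-to : ∀ a → from (to a) ≡ a
    from-to a = coordinate-injective (begin
      (p , from (to a))        ≡⟨ from-spec (to a) ⟨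
      ⟦ g ⁻¹ ⟧ (p , to a)      ≡⟨ cong ⟦ g ⁻¹ ⟧ (to-spec a) ⟨
      ⟦ g ⁻¹ ⟧ (⟦ g ⟧ (p , a)) ≡⟨ ⟦⟧-inverseʳ g (p , a) ⟩
      (p , a)                  ∎)
    to-edge : PreservesEdges (toSetGraph (G p)) (toSetGraph (G p)) to
    to-edge a b = begin
      adj (G p) (to a) (to b)       ≡⟨ ~-within p (to a) (to b) ⟨
      (p , to a) ~ (p , to b)       ≡⟨ cong₂ _~_ (to-spec a) (to-spec b) ⟨
      ⟦ g ⟧ (p , a) ~ ⟦ g ⟧ (p , b) ≡⟨ ⟦⟧-edge g (p , a) (p , b) ⟩
      (p , a) ~ (p , b)             ≡⟨ ~-within p a b ⟩
      adj (G p) a b                 ∎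
    to-ρ : to ρ ≡ ρ
    to-ρ = coordinate-injective (trans (sym (to-spec ρ)) fixes-ρ)

  ¬moreThan-part : ∀ i {X : V → Set} → (∀ w → X w → part w ≡ i) → ¬ MoreThan (n (G i)) X
  ¬moreThan-part i {X} X⊆i = ¬moreThan coordinate λ x∈X y∈X eq →
    trans (coordinate-spec x∈X) (trans (cong (i ,_) eq) (sym (coordinate-spec y∈X)))
    where
    coordinate : ∀ {x} → X x → Fin (n (G i))
    coordinate {x} x∈X = proj₁ (inPart (X⊆i x x∈X))
    coordinate-spec : ∀ {x} (x∈X : X x) → x ≡ (i , coordinate x∈X)
    coordinate-spec {x} x∈X = proj₂ (inPart (X⊆i x x∈X))

  moreThan-part+1 : ∀ i {X : V → Set} {w} → part w ≢ i → X w → (∀ a → X (i , a)) →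
    MoreThan (n (G i)) X
  moreThan-part+1 i {X} {w} w∉i w∈X i⊆X = e , e-injective , e⊆X
    where
    e : Fin (suc (n (G i))) → V
    e zero    = w
    e (suc a) = i , a
    e-injective : Injective _≡_ _≡_ e
    e-injective {zero}  {zero}  _  = refl
    e-injective {zero}  {suc _} eq = ⊥-elim (w∉i (cong part eq))
    e-injective {suc _} {zero}  eq = ⊥-elim (w∉i (cong part (sym eq)))
    e-injective {suc _} {suc _} eq = cong suc (coordinate-injective eq)
    e⊆X : ∀ p → X (e p)
    e⊆X zero    = w∈X
    e⊆X (suc a) = i⊆X a

  module RootedAt (connected : ∀ i → Connected (toSetGraph (G i)))
                  {m : ℕ} (size : ∀ i → n (G i) ≡ m) (v : V) where

    i₀ j₀ : Fin 3
    i₀ = part v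
    j₀ = proj₁ (avoid i₀ i₀)

    j₀≢i₀ : j₀ ≢ i₀
    j₀≢i₀ = proj₁ (proj₂ (avoid i₀ i₀))

    R : V
    R = root i₀

    ≢R : ∀ {w} → part w ≢ i₀ → w ≢ R
    ≢R w∉i₀ w≡R = w∉i₀ (cong part w≡R)

    ¬moreThan-m : ∀ i {X : V → Set} → (∀ w → X w → part w ≡ i) → ¬ MoreThan m X
    ¬moreThan-m i {X} X⊆i = subst (λ k → ¬ MoreThan k X) (size i) (¬moreThan-part i X⊆i)

    moreThan-m : ∀ i {X : V → Set} {w} → part w ≢ i → X w → (∀ a → X (i , a)) → MoreThan m X
    moreThan-m i {X} w∉i w∈X i⊆X =
      subst (λ k → MoreThan k X) (size i) (moreThan-part+1 i w∉i w∈X i⊆X)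

    R-large : LargeSeparator {glued} {v} m R
    R-large = moreThan-m j₀ {Separates glued v R} (j₀≢i₀ ∘ sym) (λ w → walk-end w refl)
      λ a w → j₀≢i₀ (walk-stays-in-part (λ R≢R → R≢R refl) w)

    separated-from-outside : ∀ {y} → part y ≢ i₀ → ∀ z → Separates glued v y z → part z ≡ part y
    separated-from-outside {y} y∉i₀ z y-sep-z with part z ≟ part y
    ... | yes z∈y = z∈y
    ... | no z∉y  = ⊥-elim (y-sep-z (walk-weaken (λ w∉y w≡y → w∉y (cong part w≡y))
                      (walk-between connected i₀ (part z) (λ _ → y∉i₀ ∘ sym) (λ _ → z∉y)
                                    (proj₂ v) (proj₂ z))))

    separated-from-inside : ∀ {y} → part y ≡ i₀ → Walk glued (_≢ y) v R →
      ∀ z → Separates glued v y z → part z ≡ i₀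
    separated-from-inside {y} y∈i₀ v⇝R z y-sep-z with part z ≟ i₀
    ... | yes z∈i₀ = z∈i₀
    ... | no z∉i₀  = ⊥-elim (y-sep-z (v⇝R ++ʷ walk-across (z∉i₀ ∘ sym) (walk-end v⇝R)
                       (walk-within connected (part z) (λ _ z≡y → z∉i₀ (trans (cong part z≡y) y∈i₀))
                                    _ (proj₂ z))))

    R-last : ∀ y → LargeSeparator {glued} {v} m y → Separates glued v y R
    R-last y y-large v⇝R with part y ≟ i₀
    ... | no y∉i₀  = ¬moreThan-m (part y) (separated-from-outside y∉i₀) y-large
    ... | yes y∈i₀ = ¬moreThan-m i₀ (separated-from-inside y∈i₀ v⇝R) y-large

    R-fixed : (g : RootedAutomorphism glued v) → ⟦ g ⟧ R ≡ R
    R-fixed = lastLargeSeparator-fixed _≟ᵥ_ (glued-connected connected) (R-large , R-last)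

    R-free : V → V → Set
    R-free = Walk glued (_≢ R)

    R-free-map : (g : RootedAutomorphism glued v) → ∀ {w z} →
      R-free w z → R-free (⟦ g ⟧ w) (⟦ g ⟧ z)
    R-free-map g = walk-map ⟦ g ⟧ (⟦⟧-edge g)
      λ w≢R gw≡R → w≢R (⟦⟧-injective g (trans gw≡R (sym (R-fixed g))))

    outer-root-R-free-large : ∀ j → j ≢ i₀ → MoreThan m (R-free (root j))
    outer-root-R-free-large j j≢i₀ =
      moreThan-m j {R-free (root j)} l≢j (walk-across (l≢j ∘ sym) (≢R j≢i₀) (stay (≢R l≢i₀)))
        (walk-within connected j (λ _ → ≢R j≢i₀) (r j))
      where
      l = proj₁ (avoid j i₀)
      l≢j = proj₁ (proj₂ (avoid j i₀))
      l≢i₀ = proj₂ (proj₂ (avoid j i₀))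

    large-neighbour-of-R-is-root : ∀ w → R ~ w ≡ true → MoreThan m (R-free w) → IsRoot w
    large-neighbour-of-R-is-root w R~w w-large with part w ≟ i₀
    ... | yes w∈i₀ = ⊥-elim (¬moreThan-m i₀ (λ z w⇝z → trans (walk-stays-in-part {y = z}
                       (λ w-root≢R → w-root≢R (cong root w∈i₀)) w⇝z) w∈i₀) w-large)
    ... | no w∉i₀  = cong (part w ,_) (proj₂ (~-across (w∉i₀ ∘ sym) R~w))

    roots-to-roots : (g : RootedAutomorphism glued v) → ∀ j → IsRoot (⟦ g ⟧ (root j))
    roots-to-roots g j with j ≟ i₀
    ... | yes refl = subst IsRoot (sym (R-fixed g)) refl
    ... | no j≢i₀  = large-neighbour-of-R-is-root (⟦ g ⟧ (root j)) R~gj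
                       (moreThan-map {Y = R-free (⟦ g ⟧ (root j))} ⟦ g ⟧ (⟦⟧-injective g)
                                     (R-free-map g) (outer-root-R-free-large j j≢i₀))
      where
      R~gj : R ~ ⟦ g ⟧ (root j) ≡ true
      R~gj = begin
        R ~ ⟦ g ⟧ (root j)         ≡⟨ cong (_~ ⟦ g ⟧ (root j)) (R-fixed g) ⟨
        ⟦ g ⟧ R ~ ⟦ g ⟧ (root j)   ≡⟨ ⟦⟧-edge g R (root j) ⟩
        R ~ root j                 ≡⟨ ~-roots (j≢i₀ ∘ sym) ⟩
        true                       ∎

    -- The image of part j is connected and starts at a root; were it to leave that part, it would
    -- enter another part through its root, whose preimage is a root inside part j, i.e. r j itself.
    parts-to-parts : (g : RootedAutomorphism glued v) →
      ∀ j a → part (⟦ g ⟧ (j , a)) ≡ part (⟦ g ⟧ (root j))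
    parts-to-parts g j a with part (⟦ g ⟧ (j , a)) ≟ part (⟦ g ⟧ (root j))
    ... | yes same = same
    ... | no l≢k   = ⊥-elim (l≢k (cong part (begin
          root l                     ≡⟨ ⟦⟧-inverseˡ g (root l) ⟨
          ⟦ g ⟧ (⟦ g ⁻¹ ⟧ (root l))  ≡⟨ cong ⟦ g ⟧ g⁻¹-root-l ⟩
          ⟦ g ⟧ (root j)             ∎)))
      where
      l = part (⟦ g ⟧ (j , a))
      Q : V → Set
      Q w = part (⟦ g ⁻¹ ⟧ w) ≡ j
      image-walk : Walk glued Q (root (part (⟦ g ⟧ (root j)))) (⟦ g ⟧ (j , a))
      image-walk = subst (λ x → Walk glued Q x (⟦ g ⟧ (j , a))) (roots-to-roots g j)
        (walk-map ⟦ g ⟧ (⟦⟧-edge g) (λ {w} w∈j → trans (cong part (⟦⟧-inverseʳ g w)) w∈j)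
          (walk-within connected j (λ _ → refl) (r j) a))
      g⁻¹-root-l : ⟦ g ⁻¹ ⟧ (root l) ≡ root j
      g⁻¹-root-l =
        trans (roots-to-roots (g ⁻¹) l) (cong root (walk-enters-via-root image-walk (l≢k ∘ sym)))

    fixed-vertex-keeps-part : (g : RootedAutomorphism glued v) → ∀ {p ρ} → ⟦ g ⟧ (p , ρ) ≡ (p , ρ) →
      ∀ a → part (⟦ g ⟧ (p , a)) ≡ p
    fixed-vertex-keeps-part g {p} {ρ} fixes a =
      trans (parts-to-parts g p a) (trans (sym (parts-to-parts g p ρ)) (cong part fixes))

    kept-part-root-fixed : (g : RootedAutomorphism glued v) → ∀ {j x y} → ⟦ g ⟧ (j , x) ≡ (j , y) →
      ⟦ g ⟧ (root j) ≡ root j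
    kept-part-root-fixed g {j} {x} gx≡y =
      trans (roots-to-roots g j) (cong root (trans (sym (parts-to-parts g j x)) (cong part gx≡y)))

    part-orbits : ∀ p ρ → (∀ g {x y} → ⟦ g ⟧ (p , x) ≡ (p , y) → ⟦ g ⟧ (p , ρ) ≡ (p , ρ)) →
      ∀ {I} {s : I → Fin (n (G p))} →
      DistinctOrbits (toSetGraph (G p)) ρ s → DistinctOrbits glued v ((p ,_) ∘ s)
    part-orbits p ρ fixes-ρ s-distinct i j (g , g-maps) =
      s-distinct i j (h , coordinate-injective (trans (sym (h-spec _)) g-maps))
      where
      ρ-fixed : ⟦ g ⟧ (p , ρ) ≡ (p , ρ)
      ρ-fixed = fixes-ρ g g-maps
      ρ-fixed⁻¹ : ⟦ g ⁻¹ ⟧ (p , ρ) ≡ (p , ρ)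
      ρ-fixed⁻¹ = trans (cong ⟦ g ⁻¹ ⟧ (sym ρ-fixed)) (⟦⟧-inverseʳ g _)
      restriction = restrict p ρ g ρ-fixed (fixed-vertex-keeps-part g ρ-fixed)
                                          (fixed-vertex-keeps-part (g ⁻¹) ρ-fixed⁻¹)
      h = proj₁ restriction
      h-spec = proj₂ restriction

    orbits-doubled : ∀ {M} → (∀ i a → OrbitsAtLeast (toSetGraph (G i)) a M) →
      OrbitsAtLeast glued v (M + M)
    orbits-doubled orbits =
      orbitsAtLeast-+ ((i₀ ,_) ∘ proj₁ inner) ((j₀ ,_) ∘ proj₁ outer)
        (part-orbits i₀ (proj₂ v) (λ g _ → ⟦⟧-root g) (proj₂ inner))
        (part-orbits j₀ (r j₀) (λ g → kept-part-root-fixed g) (proj₂ outer))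
        λ a b (g , g-maps) →
          j₀≢i₀ (trans (cong part (sym g-maps)) (fixed-vertex-keeps-part g (⟦⟧-root g) _))
      where
      inner = orbits i₀ (proj₂ v)
      outer = orbits j₀ (r j₀)

module Triple (G₁ G₂ G₃ : Graph) (v₁ : Fin (n G₁)) (v₂ : Fin (n G₂)) (v₃ : Fin (n G₃)) where

  G : Fin 3 → Graph
  G zero             = G₁
  G (suc zero)       = G₂
  G (suc (suc zero)) = G₃

  r : ∀ i → Fin (n (G i))
  r zero             = v₁
  r (suc zero)       = v₂
  r (suc (suc zero)) = v₃

  open Glued G r public

  fromSum : Fin (n G₁) ⊎ (Fin (n G₂) ⊎ Fin (n G₃)) → V
  fromSum (inj₁ a)        = zero , a
  fromSum (inj₂ (inj₁ a)) = suc zero , a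
  fromSum (inj₂ (inj₂ a)) = suc (suc zero) , a

  toSum : V → Fin (n G₁) ⊎ (Fin (n G₂) ⊎ Fin (n G₃))
  toSum (zero , a)           = inj₁ a
  toSum (suc zero , a)       = inj₂ (inj₁ a)
  toSum (suc (suc zero) , a) = inj₂ (inj₂ a)

  toSum-fromSum : ∀ s → toSum (fromSum s) ≡ s
  toSum-fromSum (inj₁ _)        = refl
  toSum-fromSum (inj₂ (inj₁ _)) = refl
  toSum-fromSum (inj₂ (inj₂ _)) = refl

  fromSum-toSum : ∀ w → fromSum (toSum w) ≡ w
  fromSum-toSum (zero , _)           = refl
  fromSum-toSum (suc zero , _)       = refl
  fromSum-toSum (suc (suc zero) , _) = refl

  split₃ : Fin (n G₁ + (n G₂ + n G₃)) → Fin (n G₁) ⊎ (Fin (n G₂) ⊎ Fin (n G₃))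
  split₃ x = map₂ (splitAt (n G₂)) (splitAt (n G₁) x)

  join₃ : Fin (n G₁) ⊎ (Fin (n G₂) ⊎ Fin (n G₃)) → Fin (n G₁ + (n G₂ + n G₃))
  join₃ s = join (n G₁) _ (map₂ (join (n G₂) (n G₃)) s)

  split₃-join₃ : ∀ s → split₃ (join₃ s) ≡ s
  split₃-join₃ (inj₁ a) = cong (map₂ _) (splitAt-join (n G₁) _ (inj₁ a))
  split₃-join₃ (inj₂ t) =
    trans (cong (map₂ _) (splitAt-join (n G₁) _ (inj₂ (join (n G₂) (n G₃) t))))
          (cong inj₂ (splitAt-join (n G₂) (n G₃) t))

  join₃-split₃ : ∀ x → join₃ (split₃ x) ≡ x
  join₃-split₃ x with splitAt (n G₁) x | join-splitAt (n G₁) (n G₂ + n G₃) x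
  ... | inj₁ _ | x≡ = x≡
  ... | inj₂ y | x≡ =
    trans (cong (join (n G₁) _ ∘ inj₂) (join-splitAt (n G₂) (n G₃) y)) x≡

  vertices : Fin (n (glue G₁ G₂ G₃ v₁ v₂ v₃)) ↔ V
  vertices = mk↔ₛ′ (fromSum ∘ split₃) (join₃ ∘ toSum)
    (λ w → trans (cong fromSum (split₃-join₃ (toSum w))) (fromSum-toSum w))
    (λ x → trans (cong join₃ (toSum-fromSum (split₃ x))) (join₃-split₃ x))

  edges : PreservesEdges (toSetGraph (glue G₁ G₂ G₃ v₁ v₂ v₃)) glued (fromSum ∘ split₃)
  edges x y with split₃ x | split₃ y
  ... | inj₁ a        | inj₁ b        = refl
  ... | inj₁ a        | inj₂ (inj₁ b) = refl
  ... | inj₁ a        | inj₂ (inj₂ b) = refl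
  ... | inj₂ (inj₁ a) | inj₁ b        = refl
  ... | inj₂ (inj₁ a) | inj₂ (inj₁ b) = refl
  ... | inj₂ (inj₁ a) | inj₂ (inj₂ b) = refl
  ... | inj₂ (inj₂ a) | inj₁ b        = refl
  ... | inj₂ (inj₂ a) | inj₂ (inj₁ b) = refl
  ... | inj₂ (inj₂ a) | inj₂ (inj₂ b) = refl

  glue-≅-glued : toSetGraph (glue G₁ G₂ G₃ v₁ v₂ v₃) ≅ glued
  glue-≅-glued = vertices , edges

  byPart : {P : Graph → Set} → P G₁ → P G₂ → P G₃ → ∀ i → P (G i)
  byPart p₁ p₂ p₃ zero             = p₁
  byPart p₁ p₂ p₃ (suc zero)       = p₂
  byPart p₁ p₂ p₃ (suc (suc zero)) = p₃

K₂-connected : Connected (toSetGraph K₂)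
K₂-connected zero       zero       = stay tt
K₂-connected zero       (suc zero) = step tt refl (stay tt)
K₂-connected (suc zero) zero       = step tt refl (stay tt)
K₂-connected (suc zero) (suc zero) = stay tt

K₂-orbits : ∀ x → OrbitsAtLeast (toSetGraph K₂) x 2
K₂-orbits x = representative , distinct
  where
  other : Fin 2 → Fin 2
  other zero       = suc zero
  other (suc zero) = zero
  other-≢ : ∀ y → other y ≢ y
  other-≢ zero       ()
  other-≢ (suc zero) ()
  representative : Fin 2 → Fin 2
  representative zero       = x
  representative (suc zero) = other x
  distinct : DistinctOrbits (toSetGraph K₂) x representative
  distinct zero       zero       _         = refl
  distinct (suc zero) (suc zero) _         = refl
  distinct zero       (suc zero) (g , x↦y) = ⊥-elim (other-≢ x (trans (sym x↦y) (⟦⟧-root g)))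
  distinct (suc zero) zero       o         = sym (distinct zero (suc zero) (sameOrbit-sym o))

Δ-order : ∀ {k G H} → Δ k G → Δ k H → n G ≡ n H
Δ-order (base φ) (base ψ) = trans (sym (↔⇒≡ (proj₁ φ))) (↔⇒≡ (proj₁ ψ))
Δ-order (step G₁ G₂ G₃ d₁ d₂ d₃ _ _ _ φ) (step H₁ H₂ H₃ e₁ e₂ e₃ _ _ _ ψ) =
  trans (sym (↔⇒≡ (proj₁ φ)))
    (trans (cong₂ _+_ (Δ-order d₁ e₁) (cong₂ _+_ (Δ-order d₂ e₂) (Δ-order d₃ e₃)))
           (↔⇒≡ (proj₁ ψ)))

Δ-connected : ∀ {k G} → Δ k G → Connected (toSetGraph G)
Δ-connected (base φ) = connected-≅ φ K₂-connected
Δ-connected (step G₁ G₂ G₃ d₁ d₂ d₃ v₁ v₂ v₃ φ) =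
  connected-≅ φ (connected-≅ (≅-sym glue-≅-glued)
    (glued-connected (byPart (Δ-connected d₁) (Δ-connected d₂) (Δ-connected d₃))))
  where open Triple G₁ G₂ G₃ v₁ v₂ v₃

Δ-orbits : ∀ {k G} → Δ k G → ∀ v → OrbitsAtLeast (toSetGraph G) v (2 ^ suc k)
Δ-orbits (base φ) = orbitsAtLeast-≅ φ K₂-orbits
Δ-orbits {suc k} (step G₁ G₂ G₃ d₁ d₂ d₃ v₁ v₂ v₃ φ) =
  orbitsAtLeast-≅ φ (orbitsAtLeast-≅ (≅-sym glue-≅-glued) λ v →
    subst (OrbitsAtLeast glued v) (cong (M +_) (sym (+-identityʳ M)))
      (RootedAt.orbits-doubled
        (byPart (Δ-connected d₁) (Δ-connected d₂) (Δ-connected d₃))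
        (byPart {λ H → n H ≡ n G₁} refl (Δ-order d₂ d₁) (Δ-order d₃ d₁)) v
        (byPart (Δ-orbits d₁) (Δ-orbits d₂) (Δ-orbits d₃))))
  where
  open Triple G₁ G₂ G₃ v₁ v₂ v₃
  M = 2 ^ suc k

lemma5p4 : (k : ℕ) (G : Graph) → Δ k G → (v : Fin (n G)) →
    AtLeastOrbits G v (2 ^ suc k)
lemma5p4 _ _ = Δ-orbits
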